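{- Consider an SDSP instance. Let $S=\{k_1,\dots,k_l\}\subseteq\mathcal{N}$ consist of $l$ deliveries of largest density, listed so that $d_{k_1}\ge d_{k_2}\ge\dots\ge d_{k_l}$ and $d_{k_l}\ge d_j$ for every $j\notin S$. If $S$ is compatible and critical, then $\mathcal{P}(S)\ge f(1)$.
   Context: An SDSP instance consists of deliveries $\mathcal{N}=\{1,\dots,n\}$ and one drone with battery budget $B>0$. Each delivery $j$ has a closed time interval $I_j=[t_j^L,t_j^R]$, a cost $c_j>0$ and a profit $p_j\ge0$; its density is $d_j=p_j/c_j$. Deliveries $j\ne k$ are compatible if $I_j\cap I_k=\emptyset$. A set is compatible if its elements are pairwise compatible and feasible if also $\mathcal{W}(S)=\sum_{j\in S}c_j\le B$; $\mathcal{P}(S)=\sum_{j\in S}p_j$. $f(1)$ is the maximum profit of a feasible set. The set $S=\{k_1,\dots,k_l\}$ with $d_{k_1}\ge\dots\ge d_{k_l}$ is critical if $\mathcal{W}(S)>B$ and $\mathcal{W}(S\setminus\{k_l\})\le B$.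
   Formalization: The battery budget B, the interval endpoints $t_j^L,t_j^R$, the costs $c_j$ and the profits $p_j$ are all rational numbers. -}

module Defs where

open import Data.Nat using (ℕ; zero; suc)
open import Data.Fin using (Fin; zero; suc; inject₁; fromℕ; _<_)
open import Data.Rational using (ℚ; 0ℚ; _+_; _≤_; _<_; _>_; _÷_; positive)
open import Data.Rational.Properties using (pos⇒nonZero)
open import Data.Product using (Σ; _×_; ∃)
open import Relation.Binary.PropositionalEquality using (_≡_)
open import Relation.Nullary using (¬_)
open import Function.Definitions using (Injective)

record SDSP (n : ℕ) : Set where
  field
    B      : ℚ
    B>0    : B > 0ℚ
    tL tR  : Fin n → ℚ
    tL≤tR  : ∀ j → tL j ≤ tR j
    c      : Fin n → ℚ
    c>0    : ∀ j → c j > 0ℚ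
    p      : Fin n → ℚ
    p≥0    : ∀ j → 0ℚ ≤ p j

  d : Fin n → ℚ
  d j = (p j ÷ c j) {{pos⇒nonZero (c j) {{positive (c>0 j)}}}}

  _∈I_ : ℚ → Fin n → Set
  t ∈I j = (tL j ≤ t) × (t ≤ tR j)

  CompatiblePair : Fin n → Fin n → Set
  CompatiblePair j k = ¬ (Σ ℚ λ t → (t ∈I j) × (t ∈I k))

Σ[_] : ∀ {m} → (Fin m → ℚ) → ℚ
Σ[_] {zero}  f = 0ℚ
Σ[_] {suc m} f = f zero + Σ[ (λ i → f (suc i)) ]

module _ {n : ℕ} (I : SDSP n) where
  open SDSP I

  -- A set of deliveries of size m is represented by an injective
  -- enumeration s : Fin m → Fin n of its elements.
  IsSet : ∀ {m} → (Fin m → Fin n) → Set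
  IsSet s = Injective _≡_ _≡_ s

  W : ∀ {m} → (Fin m → Fin n) → ℚ
  W s = Σ[ (λ i → c (s i)) ]

  P : ∀ {m} → (Fin m → Fin n) → ℚ
  P s = Σ[ (λ i → p (s i)) ]

  Compatible : ∀ {m} → (Fin m → Fin n) → Set
  Compatible s = ∀ i i' → ¬ (i ≡ i') → CompatiblePair (s i) (s i')

  Feasible : ∀ {m} → (Fin m → Fin n) → Set
  Feasible s = Compatible s × (W s ≤ B)

  -- s = (k_1, ..., k_l) with l = suc m, listed by non-increasing density
  SortedByDensity : ∀ {m} → (Fin (suc m) → Fin n) → Set
  SortedByDensity k = ∀ i i' → i Data.Fin.< i' → d (k i') ≤ d (k i)

  Critical : ∀ {m} → (Fin (suc m) → Fin n) → Set
  Critical {m} k = (W k > B) × (W (λ i → k (inject₁ i)) ≤ B)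

  LargestDensity : ∀ {m} → (Fin (suc m) → Fin n) → Set
  LargestDensity {m} k = ∀ j → (∀ i → ¬ (k i ≡ j)) → d j ≤ d (k (fromℕ m))

-- With δ the density of the last delivery k_l of S, the reduced profit p_j − δ c_j is
-- nonnegative on S and nonpositive off S, since S consists of deliveries of largest density.
-- Summing over any set T therefore gives P(T) − δ W(T) ≤ P(S) − δ W(S), and a feasible T
-- has W(T) ≤ B < W(S), so P(T) ≤ P(S).

module Submission where

open import Defs
open import Data.Nat using (ℕ; suc; zero)
open import Data.Fin using (Fin; zero; suc; fromℕ)
open import Data.Fin.Properties using (_≟_; suc-injective; ≤fromℕ; ≤∧≢⇒<)
open import Data.Rational using (ℚ; 0ℚ; 1ℚ; _+_; _*_; -_; _≤_; positive; nonNegative; 1/_; NonNegative; NonZero)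
open import Data.Rational.Properties
  using (+-*-commutativeRing; +-assoc; +-identityˡ; +-identityʳ; +-inverseˡ; +-inverseʳ; *-identityˡ; *-identityʳ;
         *-zeroˡ; *-assoc; *-inverseˡ; +-mono-≤; +-monoˡ-≤; neg-distribˡ-*; ≤-refl; ≤-trans; <⇒≤;
         *-monoʳ-≤-nonNeg; *-monoˡ-≤-nonNeg; pos⇒nonNeg; pos⇒nonZero; *-cancelʳ-≤-pos)
open import Algebra.Bundles using (CommutativeRing)
open import Algebra.Properties.Semiring.Sum (CommutativeRing.semiring +-*-commutativeRing)
  using (sum; sum-cong-≗; ∑-distrib-+; ∑-comm; *-distribˡ-sum; *-distribʳ-sum)
open import Data.Product using (_×_; _,_; ∃)
open import Data.Sum using (_⊎_; inj₁; inj₂)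
open import Data.Empty using (⊥-elim)
open import Function using (_∘_)
open import Function.Definitions using (Injective)
open import Relation.Nullary using (¬_; yes; no)
open import Relation.Binary.PropositionalEquality

Σ≡sum : ∀ {m} (f : Fin m → ℚ) → Σ[ f ] ≡ sum f
Σ≡sum {zero}  f = refl
Σ≡sum {suc m} f = cong (f zero +_) (Σ≡sum (f ∘ suc))

sum-mono-≤ : ∀ {m} {f g : Fin m → ℚ} → (∀ i → f i ≤ g i) → sum f ≤ sum g
sum-mono-≤ {zero}  f≤g = ≤-refl
sum-mono-≤ {suc m} f≤g = +-mono-≤ (f≤g zero) (sum-mono-≤ (f≤g ∘ suc))

kronecker : ∀ {n} → Fin n → Fin n → ℚ
kronecker zero    zero    = 1ℚ
kronecker zero    (suc j) = 0ℚ
kronecker (suc i) zero    = 0ℚ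
kronecker (suc i) (suc j) = kronecker i j

kronecker-refl : ∀ {n} (i : Fin n) → kronecker i i ≡ 1ℚ
kronecker-refl zero    = refl
kronecker-refl (suc i) = kronecker-refl i

kronecker-≢ : ∀ {n} {i j : Fin n} → ¬ i ≡ j → kronecker i j ≡ 0ℚ
kronecker-≢ {i = zero}  {zero}  i≢j = ⊥-elim (i≢j refl)
kronecker-≢ {i = zero}  {suc j} i≢j = refl
kronecker-≢ {i = suc i} {zero}  i≢j = refl
kronecker-≢ {i = suc i} {suc j} i≢j = kronecker-≢ (i≢j ∘ cong suc)

sum-kronecker : ∀ {n} (i : Fin n) (F : Fin n → ℚ) → sum (λ j → kronecker i j * F j) ≡ F i
sum-kronecker {suc n} zero F = begin
  1ℚ * F zero + sum (λ j → 0ℚ * F (suc j)) ≡⟨ cong₂ _+_ (*-identityˡ (F zero)) (sum-cong-≗ (*-zeroˡ ∘ F ∘ suc)) ⟩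
  F zero + sum {n} (λ _ → 0ℚ)              ≡⟨ cong (F zero +_) (sum-zero n) ⟩
  F zero + 0ℚ                              ≡⟨ +-identityʳ (F zero) ⟩
  F zero                                   ∎
  where
  open ≡-Reasoning
  sum-zero : ∀ m → sum {m} (λ _ → 0ℚ) ≡ 0ℚ
  sum-zero zero    = refl
  sum-zero (suc m) = cong (0ℚ +_) (sum-zero m)
sum-kronecker {suc n} (suc i) F = begin
  0ℚ * F zero + sum (λ j → kronecker i j * F (suc j)) ≡⟨ cong₂ _+_ (*-zeroˡ (F zero)) (sum-kronecker i (F ∘ suc)) ⟩
  0ℚ + F (suc i)                                     ≡⟨ +-identityˡ (F (suc i)) ⟩
  F (suc i)                                          ∎
  where open ≡-Reasoning

multiplicity : ∀ {m n} → (Fin m → Fin n) → Fin n → ℚ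
multiplicity s j = sum (λ i → kronecker (s i) j)

sum-∘-multiplicity : ∀ {m n} (s : Fin m → Fin n) (F : Fin n → ℚ) →
                     sum (F ∘ s) ≡ sum (λ j → multiplicity s j * F j)
sum-∘-multiplicity s F = begin
  sum (F ∘ s)                                         ≡⟨ sum-cong-≗ (λ i → sym (sum-kronecker (s i) F)) ⟩
  sum (λ i → sum (λ j → kronecker (s i) j * F j))     ≡⟨ ∑-comm (λ i j → kronecker (s i) j * F j) ⟩
  sum (λ j → sum (λ i → kronecker (s i) j * F j))     ≡⟨ sum-cong-≗ (λ j → sym (*-distribʳ-sum (F j) (λ i → kronecker (s i) j))) ⟩
  sum (λ j → multiplicity s j * F j)                  ∎
  where open ≡-Reasoning

multiplicity-injective : ∀ {m n} {s : Fin m → Fin n} → Injective _≡_ _≡_ s → ∀ j →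
                         (multiplicity s j ≡ 0ℚ × (∀ i → ¬ s i ≡ j)) ⊎
                         (multiplicity s j ≡ 1ℚ × ∃ λ i → s i ≡ j)
multiplicity-injective {zero} s-inj j = inj₁ (refl , λ ())
multiplicity-injective {suc m} {s = s} s-inj j
  with s zero ≟ j | multiplicity-injective {s = s ∘ suc} (suc-injective ∘ s-inj) j
... | yes s₀≡j | inj₁ (μ≡0 , _) =
  inj₂ (cong₂ _+_ (trans (cong (kronecker (s zero)) (sym s₀≡j)) (kronecker-refl (s zero))) μ≡0 , zero , s₀≡j)
... | yes s₀≡j | inj₂ (_ , i , sᵢ≡j) with s-inj (trans sᵢ≡j (sym s₀≡j))
...   | ()
multiplicity-injective {suc m} {s = s} s-inj j | no s₀≢j | inj₁ (μ≡0 , j∉s) =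
  inj₁ (cong₂ _+_ (kronecker-≢ s₀≢j) μ≡0 , λ { zero → s₀≢j ; (suc i) → j∉s i })
multiplicity-injective {suc m} {s = s} s-inj j | no s₀≢j | inj₂ (μ≡1 , i , sᵢ≡j) =
  inj₂ (cong₂ _+_ (kronecker-≢ s₀≢j) μ≡1 , suc i , sᵢ≡j)

sum-∘-injective-≤ : ∀ {l m n} {s : Fin l → Fin n} {t : Fin m → Fin n} →
                    Injective _≡_ _≡_ s → Injective _≡_ _≡_ t → (q : Fin n → ℚ) →
                    (∀ i → 0ℚ ≤ q (s i)) → (∀ j → (∀ i → ¬ s i ≡ j) → q j ≤ 0ℚ) →
                    sum (q ∘ t) ≤ sum (q ∘ s)
sum-∘-injective-≤ {s = s} {t} s-inj t-inj q q≥0 q≤0 =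
  subst₂ _≤_ (sym (sum-∘-multiplicity t q)) (sym (sum-∘-multiplicity s q)) (sum-mono-≤ pointwise)
  where
  pointwise : ∀ j → multiplicity t j * q j ≤ multiplicity s j * q j
  pointwise j with multiplicity-injective s-inj j | multiplicity-injective t-inj j
  ... | inj₁ (μs≡0 , _)      | inj₁ (μt≡0 , _) rewrite μs≡0 | μt≡0 = ≤-refl
  ... | inj₂ (μs≡1 , _)      | inj₂ (μt≡1 , _) rewrite μs≡1 | μt≡1 = ≤-refl
  ... | inj₁ (μs≡0 , j∉s)    | inj₂ (μt≡1 , _) rewrite μs≡0 | μt≡1 =
    subst₂ _≤_ (sym (*-identityˡ (q j))) (sym (*-zeroˡ (q j))) (q≤0 j j∉s)
  ... | inj₂ (μs≡1 , i , refl) | inj₁ (μt≡0 , _) rewrite μs≡1 | μt≡0 =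
    subst₂ _≤_ (sym (*-zeroˡ (q (s i)))) (sym (*-identityˡ (q (s i)))) (q≥0 i)

0≤-+-neg : ∀ {a b} → a ≤ b → 0ℚ ≤ b + - a
0≤-+-neg {a} {b} a≤b = subst (_≤ b + - a) (+-inverseʳ a) (+-monoˡ-≤ (- a) a≤b)

+-neg≤0 : ∀ {a b} → a ≤ b → a + - b ≤ 0ℚ
+-neg≤0 {a} {b} a≤b = subst (a + - b ≤_) (+-inverseʳ b) (+-monoˡ-≤ (- b) a≤b)

+-neg-+-cancel : ∀ a b → a + - b + b ≡ a
+-neg-+-cancel a b = begin
  a + - b + b   ≡⟨ +-assoc a (- b) b ⟩
  a + (- b + b) ≡⟨ cong (a +_) (+-inverseˡ b) ⟩
  a + 0ℚ        ≡⟨ +-identityʳ a ⟩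
  a             ∎
  where open ≡-Reasoning

≤-cancel-penalty : ∀ {a b x y} → x ≤ y → a + - x ≤ b + - y → a ≤ b
≤-cancel-penalty {a} {b} {x} {y} x≤y ineq =
  subst₂ _≤_ (+-neg-+-cancel a x) (+-neg-+-cancel b y) (+-mono-≤ ineq x≤y)

module _ {n : ℕ} (I : SDSP n) where
  open SDSP I

  reducedProfit : ℚ → Fin n → ℚ
  reducedProfit δ j = p j + - (δ * c j)

  private
    instance
      cost-nonNeg : ∀ {j} → NonNegative (c j)
      cost-nonNeg {j} = pos⇒nonNeg (c j) {{positive (c>0 j)}}

  density-*-cost : ∀ j → d j * c j ≡ p j
  density-*-cost j = begin
    p j * 1/ c j * c j   ≡⟨ *-assoc (p j) _ (c j) ⟩
    p j * (1/ c j * c j) ≡⟨ cong (p j *_) (*-inverseˡ (c j)) ⟩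
    p j * 1ℚ             ≡⟨ *-identityʳ (p j) ⟩
    p j                  ∎
    where
    open ≡-Reasoning
    instance
      cost-nonZero : NonZero (c j)
      cost-nonZero = pos⇒nonZero (c j) {{positive (c>0 j)}}

  density-nonNeg : ∀ j → 0ℚ ≤ d j
  density-nonNeg j = *-cancelʳ-≤-pos (c j) {{positive (c>0 j)}}
    (subst₂ _≤_ (sym (*-zeroˡ (c j))) (sym (density-*-cost j)) (p≥0 j))

  reducedProfit-nonNeg : ∀ {δ j} → δ ≤ d j → 0ℚ ≤ reducedProfit δ j
  reducedProfit-nonNeg {δ} {j} δ≤dⱼ =
    0≤-+-neg (subst (δ * c j ≤_) (density-*-cost j) (*-monoʳ-≤-nonNeg (c j) δ≤dⱼ))

  reducedProfit-nonPos : ∀ {δ j} → d j ≤ δ → reducedProfit δ j ≤ 0ℚ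
  reducedProfit-nonPos {δ} {j} dⱼ≤δ =
    +-neg≤0 (subst (_≤ δ * c j) (density-*-cost j) (*-monoʳ-≤-nonNeg (c j) dⱼ≤δ))

  sum-reducedProfit : ∀ δ {m} (s : Fin m → Fin n) → sum (reducedProfit δ ∘ s) ≡ P I s + - (δ * W I s)
  sum-reducedProfit δ s = begin
    sum (reducedProfit δ ∘ s)                   ≡⟨ ∑-distrib-+ (p ∘ s) (λ i → - (δ * c (s i))) ⟩
    sum (p ∘ s) + sum (λ i → - (δ * c (s i)))   ≡⟨ cong (sum (p ∘ s) +_) (sum-cong-≗ (neg-distribˡ-* δ ∘ c ∘ s)) ⟩
    sum (p ∘ s) + sum (λ i → - δ * c (s i))     ≡⟨ cong (sum (p ∘ s) +_) (sym (*-distribˡ-sum (- δ) (c ∘ s))) ⟩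
    sum (p ∘ s) + - δ * sum (c ∘ s)             ≡⟨ cong₂ _+_ (sym (Σ≡sum (p ∘ s))) (sym (neg-distribˡ-* δ _)) ⟩
    P I s + - (δ * sum (c ∘ s))                 ≡⟨ cong (λ w → P I s + - (δ * w)) (sym (Σ≡sum (c ∘ s))) ⟩
    P I s + - (δ * W I s)                       ∎
    where open ≡-Reasoning

  P-≤-by-density-threshold :
    ∀ {l m} {S : Fin l → Fin n} {T : Fin m → Fin n} (δ : ℚ) → 0ℚ ≤ δ →
    IsSet I S → IsSet I T → (∀ i → δ ≤ d (S i)) → (∀ j → (∀ i → ¬ S i ≡ j) → d j ≤ δ) →
    W I T ≤ W I S → P I T ≤ P I S
  P-≤-by-density-threshold {S = S} {T} δ 0≤δ S-inj T-inj δ≤d-in d≤δ-out WT≤WS =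
    ≤-cancel-penalty (*-monoˡ-≤-nonNeg δ {{nonNegative 0≤δ}} WT≤WS)
      (subst₂ _≤_ (sum-reducedProfit δ T) (sum-reducedProfit δ S)
        (sum-∘-injective-≤ S-inj T-inj (reducedProfit δ)
          (reducedProfit-nonNeg ∘ δ≤d-in) (λ j j∉S → reducedProfit-nonPos (d≤δ-out j j∉S))))

  sorted-last-minimal : ∀ {m} {k : Fin (suc m) → Fin n} → SortedByDensity I k →
                        ∀ i → d (k (fromℕ m)) ≤ d (k i)
  sorted-last-minimal {m} sorted i with i ≟ fromℕ m
  ... | yes refl = ≤-refl
  ... | no i≢last = sorted i (fromℕ m) (≤∧≢⇒< (≤fromℕ i) i≢last)

lemma1 : {n : ℕ} (I : SDSP n) {m : ℕ} (k : Fin (suc m) → Fin n) →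
         IsSet I k → SortedByDensity I k → LargestDensity I k →
         Compatible I k → Critical I k →
         ∀ {m'} (T : Fin m' → Fin n) → IsSet I T → Feasible I T →
         P I T ≤ P I k
lemma1 I {m} k k-inj sorted largest _ (B<Wk , _) T T-inj (_ , WT≤B) =
  P-≤-by-density-threshold I (SDSP.d I (k (fromℕ m))) (density-nonNeg I _) k-inj T-inj
    (sorted-last-minimal I sorted) largest (≤-trans WT≤B (<⇒≤ B<Wk))
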